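{- Let $G$ be an undirected graph and $P,Q$ simple paths in $G$ of length $k$. Let $R$ be a loose path for $(G,P,Q)$ such that $P$ can be reconfigured into a path that uses at least one vertex of $R$. Then for every vertex $v$ of $R$, $P$ can be reconfigured into a sub-path of $R$ having $v$ as an endpoint.
   Context: The length of a path is its number of edges. A loose path for $(G,P,Q)$ is a simple path $R$ in $G$ of length $2k$ that is vertex-disjoint from both $P$ and $Q$. A reconfiguration step is a pair of edges $(e,f)$; it may be applied to a simple path when $f$ is one of its two end edges, $e$ is incident to the end vertex at the other end, and adding $e$ and removing $f$ yields another simple path (the result). $P$ can be reconfigured into a path $P'$ if some sequence of applicable steps takes $P$ to $P'$. -}

module Defs where

open import Data.Nat using (ℕ; suc; _*_)
open import Data.Fin using (Fin)
open import Data.List using (List; []; _∷_; _++_; [_]; length; reverse; head; last)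
open import Data.List.Membership.Propositional using (_∈_; _∉_)
open import Data.List.Relation.Unary.Unique.Propositional using (Unique)
open import Data.List.Relation.Unary.Linked using (Linked)
open import Data.Product using (Σ; ∃; ∃-syntax; _×_)
open import Data.Sum using (_⊎_)
open import Data.Maybe using (just)
open import Relation.Nullary using (¬_)
open import Relation.Binary.PropositionalEquality using (_≡_)
open import Relation.Binary.Construct.Closure.ReflexiveTransitive using (Star)

record Graph (n : ℕ) : Set₁ where
  field
    E       : Fin n → Fin n → Set
    E-sym   : ∀ {x y} → E x y → E y x
    E-irrefl : ∀ {x} → ¬ E x x

module _ {n : ℕ} (G : Graph n) where
  open Graph G

  IsPath : List (Fin n) → Set
  IsPath p = Linked E p × Unique p

  -- path of length k (k edges, i.e. k+1 vertices)
  IsPathOfLength : ℕ → List (Fin n) → Set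
  IsPathOfLength k p = IsPath p × length p ≡ suc k

  -- A reconfiguration step: remove one end edge f and add an edge e
  -- incident to the end vertex at the other end, the result being a
  -- simple path.
  --  * f = v u₁ (front), e = u w (back):  v ∷ rest ++ [u]  ↦  rest ++ [u] ++ [w]
  --  * f = u v (back),   e = w u (front): u ∷ rest ++ [v]  ↦  w ∷ u ∷ rest
  data Step : List (Fin n) → List (Fin n) → Set where
    atBack  : ∀ v rest u w → E u w → IsPath (rest ++ u ∷ w ∷ []) →
              Step (v ∷ rest ++ [ u ]) (rest ++ u ∷ w ∷ [])
    atFront : ∀ u rest v w → E w u → IsPath (w ∷ u ∷ rest) →
              Step (u ∷ rest ++ [ v ]) (w ∷ u ∷ rest)

  Reconf : List (Fin n) → List (Fin n) → Set
  Reconf = Star Step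

  -- P can be reconfigured into the path (subgraph) with vertex sequence P',
  -- i.e. into P' read in either direction.
  ReconfInto : List (Fin n) → List (Fin n) → Set
  ReconfInto p p' = Reconf p p' ⊎ Reconf p (reverse p')

  IsLoosePath : ℕ → List (Fin n) → List (Fin n) → List (Fin n) → Set
  IsLoosePath k P Q R =
    IsPathOfLength (2 * k) R × (∀ x → x ∈ R → x ∉ P × x ∉ Q)

-- S is a sub-path of R: a contiguous segment of R's vertex sequence
-- (as subgraph, read in either direction; reversal handled by ReconfInto).
IsSubPath : ∀ {n} → List (Fin n) → List (Fin n) → Set
IsSubPath S R = ∃[ xs ] ∃[ ys ] (xs ++ S ++ ys ≡ R)

IsEndpoint : ∀ {n} → Fin n → List (Fin n) → Set
IsEndpoint v S = head S ≡ just v ⊎ last S ≡ just v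

-- P avoids R, yet some reconfiguration sequence of P reaches a path
-- meeting R.  Look at the first step whose new end vertex w lies on R: just
-- after it, P has become a path D ++ [w] (read in a suitable direction) with
-- D off R and |D| = k.  Since R has 2k+1 vertices, w has at least k
-- successors in one of the two directions along R; the path D ++ [w] can
-- crawl along R in that direction until it is a window (a sub-path of k+1
-- consecutive vertices) of R.  Finally, all windows of the same length >= 2
-- of a path are mutually reachable by sliding one vertex at a time, and some
-- window of length k+1 has the prescribed vertex v of R as an endpoint.

module Submission where

open import Defs
open import Data.Nat using (ℕ; suc; _+_; _*_; _≤_; _<_; s≤s; z≤n)
open import Data.Nat.Properties
  using (suc-injective; +-suc; +-identityʳ; ≤-total; +-monoʳ-≤; +-cancelʳ-≤;
         m≤n⇒m⊓n≡m; <-irrefl; ≤-trans)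
open import Data.Fin using (Fin)
open import Data.Fin.Properties using (_≟_)
open import Data.List
  using (List; []; _∷_; _++_; [_]; length; reverse; reverseAcc; last;
         take; drop; initLast; _∷ʳ_; _∷ʳ′_)
open import Data.List.Properties
  using (∷-injectiveˡ; ∷-injectiveʳ; ++-assoc; ++-identityʳ; length-++;
         length-++-≤ˡ; length-++-≤ʳ; unfold-reverse; reverse-++;
         reverse-involutive; length-reverse; length-take; take++drop≡id)
open import Data.List.Membership.Propositional using (_∈_; _∉_)
open import Data.List.Membership.Propositional.Properties
  using (∈-++⁺ˡ; ∈-++⁺ʳ; ∈-++⁻; ∈-∃++)
open import Data.List.Relation.Unary.Any using (here; there)
open import Data.List.Relation.Unary.Any.Properties using (reverse⁺; reverse⁻)
open import Data.List.Relation.Unary.All using (_∷_)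
import Data.List.Relation.Unary.All.Properties as All
open import Data.List.Relation.Unary.AllPairs using ([]; _∷_)
open import Data.List.Relation.Unary.Unique.Propositional using (Unique)
import Data.List.Relation.Unary.Unique.Propositional.Properties as Unique
import Data.List.Relation.Binary.Permutation.Setoid as Perm
import Data.List.Relation.Binary.Permutation.Setoid.Properties as PermProps
open import Data.List.Relation.Unary.Linked using (Linked; []; [-]; _∷_)
import Data.List.Relation.Unary.Linked as Linked
open import Data.Product using (∃-syntax; ∃₂; _×_; _,_; proj₁; swap)
open import Data.Sum using (_⊎_; inj₁; inj₂)
import Data.Sum as Sum
open import Data.Maybe using (just)
open import Data.Empty using (⊥-elim)
open import Relation.Nullary using (¬_; yes; no)
open import Relation.Binary.PropositionalEquality
  using (_≡_; refl; sym; trans; cong; cong₂; subst; subst₂; setoid; module ≡-Reasoning)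
open import Relation.Binary.Construct.Closure.ReflexiveTransitive using (ε; _◅_; _◅◅_)

open ≡-Reasoning

module _ {A : Set} where

  ++-prefix-unique : ∀ (xs ys : List A) {us vs} →
                     xs ++ us ≡ ys ++ vs → length xs ≡ length ys → xs ≡ ys
  ++-prefix-unique []       []       _  _   = refl
  ++-prefix-unique []       (_ ∷ _)  _  ()
  ++-prefix-unique (_ ∷ _)  []       _  ()
  ++-prefix-unique (x ∷ xs) (y ∷ ys) eq len =
    cong₂ _∷_ (∷-injectiveˡ eq) (++-prefix-unique xs ys (∷-injectiveʳ eq) (suc-injective len))

  length-snoc : ∀ (xs : List A) {y} → length (xs ++ [ y ]) ≡ suc (length xs)
  length-snoc []       = refl
  length-snoc (_ ∷ xs) = cong suc (length-snoc xs)

  two-ends : ∀ x (xs : List A) y → 1 < length (x ∷ xs ++ [ y ])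
  two-ends x xs y = subst (1 <_) (sym (cong suc (length-snoc xs))) (s≤s (s≤s z≤n))

  infix-shorter : ∀ (a : A) xs ws ys → length ws < length (a ∷ xs ++ ws ++ ys)
  infix-shorter a xs ws ys = s≤s (≤-trans (length-++-≤ˡ ws) (length-++-≤ʳ (ws ++ ys) {xs}))

  last-snoc : ∀ (xs : List A) y → last (xs ++ [ y ]) ≡ just y
  last-snoc []           y = refl
  last-snoc (_ ∷ [])     y = refl
  last-snoc (_ ∷ x ∷ xs) y = last-snoc (x ∷ xs) y

  reverse-ends : ∀ (x : A) xs y → reverse (x ∷ xs ++ [ y ]) ≡ y ∷ reverse xs ++ [ x ]
  reverse-ends x xs y = begin
    reverse (x ∷ xs ++ [ y ])       ≡⟨ unfold-reverse x (xs ++ [ y ]) ⟩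
    reverse (xs ++ [ y ]) ++ [ x ]  ≡⟨ cong (_++ [ x ]) (reverse-++ xs [ y ]) ⟩
    y ∷ reverse xs ++ [ x ]         ∎

  reverse-around : ∀ xs (v : A) ys → reverse (xs ++ v ∷ ys) ≡ reverse ys ++ v ∷ reverse xs
  reverse-around xs v ys = begin
    reverse (xs ++ v ∷ ys)                ≡⟨ reverse-++ xs (v ∷ ys) ⟩
    reverse (v ∷ ys) ++ reverse xs        ≡⟨ cong (_++ reverse xs) (unfold-reverse v ys) ⟩
    (reverse ys ++ [ v ]) ++ reverse xs   ≡⟨ ++-assoc (reverse ys) [ v ] (reverse xs) ⟩
    reverse ys ++ v ∷ reverse xs          ∎

  module _ {_~_ : A → A → Set} where

    linked-prefix : ∀ xs {ys} → Linked _~_ (xs ++ ys) → Linked _~_ xs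
    linked-prefix []           _       = []
    linked-prefix (_ ∷ [])     _       = [-]
    linked-prefix (_ ∷ y ∷ xs) (r ∷ l) = r ∷ linked-prefix (y ∷ xs) l

    linked-suffix : ∀ xs {ys} → Linked _~_ (xs ++ ys) → Linked _~_ ys
    linked-suffix []       l = l
    linked-suffix (_ ∷ xs) l = linked-suffix xs (Linked.tail l)

    linked-glue : ∀ xs {w ys} → Linked _~_ (xs ++ [ w ]) → Linked _~_ (w ∷ ys) →
                  Linked _~_ (xs ++ w ∷ ys)
    linked-glue []           _           l = l
    linked-glue (_ ∷ [])     (r ∷ [-])   l = r ∷ l
    linked-glue (_ ∷ y ∷ xs) (r ∷ l₁)    l = r ∷ linked-glue (y ∷ xs) l₁ l

    linked-reverse : (∀ {x y} → x ~ y → y ~ x) → ∀ {xs} → Linked _~_ xs → Linked _~_ (reverse xs)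
    linked-reverse ~-sym {[]}     _ = []
    linked-reverse ~-sym {x ∷ xs} l = accumulate xs l [-]
      where
      accumulate : ∀ {x} xs {ys} → Linked _~_ (x ∷ xs) → Linked _~_ (x ∷ ys) →
                   Linked _~_ (reverseAcc (x ∷ ys) xs)
      accumulate []       _       l′ = l′
      accumulate (_ ∷ xs) (r ∷ l) l′ = accumulate xs l (~-sym r ∷ l′)

  unique-prefix : ∀ xs {ys : List A} → Unique (xs ++ ys) → Unique xs
  unique-prefix []       _         = []
  unique-prefix (_ ∷ xs) (x∉ ∷ u) = All.++⁻ˡ xs x∉ ∷ unique-prefix xs u

  unique-suffix : ∀ xs {ys : List A} → Unique (xs ++ ys) → Unique ys
  unique-suffix []       u       = u
  unique-suffix (_ ∷ xs) (_ ∷ u) = unique-suffix xs u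

  unique-last : ∀ xs {w : A} → Unique (xs ++ [ w ]) → w ∉ xs
  unique-last (_ ∷ xs) (x∉ ∷ _) (here refl) with All.++⁻ʳ xs x∉
  ... | x≢x ∷ _ = x≢x refl
  unique-last (_ ∷ xs) (_ ∷ u)  (there w∈) = unique-last xs u w∈

  unique-reverse : ∀ {xs : List A} → Unique xs → Unique (reverse xs)
  unique-reverse {xs} =
    PermProps.Unique-resp-↭ (setoid A) (Perm.↭-sym (setoid A) (PermProps.↭-reverse (setoid A) xs))

module _ {n : ℕ} where

  private
    V : Set
    V = Fin n

  subpath-∈ : ∀ {S R : List V} {y} → IsSubPath S R → y ∈ S → y ∈ R
  subpath-∈ (xs , _ , refl) y∈S = ∈-++⁺ʳ xs (∈-++⁺ˡ y∈S)

  subpath-unreverse : ∀ {S R : List V} → IsSubPath S (reverse R) → IsSubPath (reverse S) R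
  subpath-unreverse {S} {R} (xs , ys , eq) = reverse ys , reverse xs , (begin
    reverse ys ++ reverse S ++ reverse xs    ≡⟨ ++-assoc (reverse ys) (reverse S) (reverse xs) ⟨
    (reverse ys ++ reverse S) ++ reverse xs  ≡⟨ cong (_++ reverse xs) (reverse-++ S ys) ⟨
    reverse (S ++ ys) ++ reverse xs          ≡⟨ reverse-++ xs (S ++ ys) ⟨
    reverse (xs ++ S ++ ys)                  ≡⟨ cong reverse eq ⟩
    reverse (reverse R)                      ≡⟨ reverse-involutive R ⟩
    R                                        ∎)

  Ahead : ℕ → List V → V → Set
  Ahead k R v = ∃₂ λ X Y → R ≡ X ++ v ∷ Y × k ≤ length Y

  longSide : ∀ {k} {R : List V} {v} → length R ≡ suc (2 * k) → v ∈ R →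
             Ahead k R v ⊎ Ahead k (reverse R) v
  longSide {k} {R} {v} lenR v∈R with ∈-∃++ v∈R
  ... | X , Y , R≡ with ≤-total k (length Y)
  ...   | inj₁ k≤Y = inj₁ (X , Y , R≡ , k≤Y)
  ...   | inj₂ Y≤k =
    inj₂ (reverse Y , reverse X , trans (cong reverse R≡) (reverse-around X v Y) ,
          subst (k ≤_) (sym (length-reverse X)) k≤X)
    where
    sides : length X + length Y ≡ k + k
    sides = suc-injective (begin
      suc (length X + length Y)  ≡⟨ +-suc (length X) (length Y) ⟨
      length X + suc (length Y)  ≡⟨ length-++ X ⟨
      length (X ++ v ∷ Y)        ≡⟨ cong length R≡ ⟨
      length R                   ≡⟨ lenR ⟩
      suc (k + (k + 0))          ≡⟨ cong (λ m → suc (k + m)) (+-identityʳ k) ⟩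
      suc (k + k)                ∎)
    k≤X : k ≤ length X
    k≤X = +-cancelʳ-≤ k k (length X) (subst (_≤ length X + k) sides (+-monoʳ-≤ (length X) Y≤k))

  aheadWindow : ∀ {k} {R : List V} {v} → Ahead k R v → ∃[ C ] (IsSubPath (v ∷ C) R × length C ≡ k)
  aheadWindow {k} {v = v} (X , Y , R≡ , k≤Y) =
    take k Y ,
    (X , drop k Y , trans (cong (λ t → X ++ v ∷ t) (take++drop≡id k Y)) (sym R≡)) ,
    trans (length-take k Y) (m≤n⇒m⊓n≡m k≤Y)

  endWindow : ∀ {k} {R : List V} {v} → length R ≡ suc (2 * k) → v ∈ R →
              ∃[ S ] (IsSubPath S R × length S ≡ suc k × IsEndpoint v S)
  endWindow lenR v∈R with longSide lenR v∈R
  ... | inj₁ ahead with aheadWindow ahead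
  ...   | C , sub , lenC = _ , sub , cong suc lenC , inj₁ refl
  endWindow {v = v} lenR v∈R | inj₂ ahead with aheadWindow ahead
  ...   | C , sub , lenC =
    reverse (v ∷ C) , subpath-unreverse sub ,
    trans (length-reverse (v ∷ C)) (cong suc lenC) ,
    inj₂ (subst (λ t → last t ≡ just v) (sym (unfold-reverse v C)) (last-snoc (reverse C) v))

module _ {n : ℕ} (G : Graph n) where
  open Graph G

  private
    V : Set
    V = Fin n

    Path : List V → Set
    Path = IsPath G

  path-prefix : ∀ xs {ys} → Path (xs ++ ys) → Path xs
  path-prefix xs (l , u) = linked-prefix xs l , unique-prefix xs u

  path-suffix : ∀ xs {ys} → Path (xs ++ ys) → Path ys
  path-suffix xs (l , u) = linked-suffix xs l , unique-suffix xs u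

  path-reverse : ∀ {p} → Path p → Path (reverse p)
  path-reverse (l , u) = linked-reverse E-sym l , unique-reverse u

  subpath-path : ∀ {S R} → IsSubPath S R → Path R → Path S
  subpath-path {S} (xs , _ , refl) p = path-prefix S (path-suffix xs p)

  path-glue : ∀ D {w C} → Path (D ++ [ w ]) → Path (w ∷ C) → (∀ y → y ∈ D → y ∉ C) →
              Path (D ++ w ∷ C)
  path-glue D {w} {C} (l₁ , u₁) (l₂ , u₂) disjoint =
    linked-glue D l₁ l₂ , Unique.++⁺ (unique-prefix D u₁) u₂ apart
    where
    apart : ∀ {y} → ¬ (y ∈ D × y ∈ w ∷ C)
    apart (y∈D , here refl) = unique-last D u₁ y∈D
    apart (y∈D , there y∈C) = disjoint _ y∈D y∈C

  step-path : ∀ {p q} → Step G p q → Path q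
  step-path (atBack _ _ _ _ _ pth)  = pth
  step-path (atFront _ _ _ _ _ pth) = pth

  step-length : ∀ {p q} → Step G p q → length q ≡ length p
  step-length (atBack v rest u w _ _) = begin
    length (rest ++ u ∷ w ∷ [])        ≡⟨ cong length (++-assoc rest [ u ] [ w ]) ⟨
    length ((rest ++ [ u ]) ++ [ w ])  ≡⟨ length-snoc (rest ++ [ u ]) ⟩
    suc (length (rest ++ [ u ]))       ∎
  step-length (atFront u rest v w _ _) = cong suc (sym (length-snoc rest))

  step-long : ∀ {p q} → Step G p q → 1 < length p
  step-long (atBack v rest u _ _ _)  = two-ends v rest u
  step-long (atFront u rest v _ _ _) = two-ends u rest v

  -- A step read backwards is a step: the two kinds of steps are mirror images.
  step-reverse : ∀ {p q} → Step G p q → Step G (reverse p) (reverse q)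
  step-reverse (atBack v rest u w e pth) =
    subst₂ (Step G) (sym (reverse-ends v rest u)) (sym flipped)
      (atFront u (reverse rest) v w (E-sym e) (subst Path flipped (path-reverse pth)))
    where
    flipped : reverse (rest ++ u ∷ w ∷ []) ≡ w ∷ u ∷ reverse rest
    flipped = reverse-++ rest (u ∷ w ∷ [])
  step-reverse (atFront u rest v w e pth) =
    subst₂ (Step G) (sym (reverse-ends u rest v)) (sym flipped)
      (atBack v (reverse rest) u w (E-sym e) (subst Path flipped (path-reverse pth)))
    where
    flipped : reverse (w ∷ u ∷ rest) ≡ reverse rest ++ u ∷ w ∷ []
    flipped = reverse-++ (w ∷ u ∷ []) rest

  reconf-reverse : ∀ {p q} → Reconf G p q → Reconf G (reverse p) (reverse q)
  reconf-reverse ε       = ε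
  reconf-reverse (s ◅ r) = step-reverse s ◅ reconf-reverse r

  reconf-path : ∀ {p q} → Path p → Reconf G p q → Path q
  reconf-path pth ε       = pth
  reconf-path _   (s ◅ r) = reconf-path (step-path s) r

  reconf-length : ∀ {p q} → Reconf G p q → length q ≡ length p
  reconf-length ε       = refl
  reconf-length (s ◅ r) = trans (reconf-length r) (step-length s)

  into-reverse : ∀ {p T} → ReconfInto G p T → ReconfInto G p (reverse T)
  into-reverse {p} {T} (inj₁ r) = inj₂ (subst (Reconf G p) (sym (reverse-involutive T)) r)
  into-reverse         (inj₂ r) = inj₁ r

  into-then : ∀ {p T S} → ReconfInto G p T → Reconf G T S → ReconfInto G p S
  into-then (inj₁ r) r′ = inj₁ (r ◅◅ r′)
  into-then (inj₂ r) r′ = inj₂ (r ◅◅ reconf-reverse r′)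

  into-path : ∀ {p T} → Path p → ReconfInto G p T → Path T
  into-path         pth (inj₁ r) = reconf-path pth r
  into-path {T = T} pth (inj₂ r) =
    subst Path (reverse-involutive T) (path-reverse (reconf-path pth r))

  into-length : ∀ {p T} → ReconfInto G p T → length T ≡ length p
  into-length         (inj₁ r) = reconf-length r
  into-length {T = T} (inj₂ r) = trans (sym (length-reverse T)) (reconf-length r)

  _⇄_ : List V → List V → Set
  p ⇄ q = Reconf G p q × Reconf G q p

  ⇄-refl : ∀ {p} → p ⇄ p
  ⇄-refl = ε , ε

  ⇄-trans : ∀ {p q r} → p ⇄ q → q ⇄ r → p ⇄ r
  ⇄-trans (pq , qp) (qr , rq) = pq ◅◅ qr , rq ◅◅ qp

  slide-forward : ∀ a ys b → 0 < length ys → Path (a ∷ ys ++ [ b ]) → Step G (a ∷ ys) (ys ++ [ b ])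
  slide-forward a ys b nonempty pth with initLast ys
  slide-forward a .[] b () pth | []
  slide-forward a .(rest ∷ʳ u) b _ pth | rest ∷ʳ′ u =
    subst (Step G (a ∷ rest ∷ʳ u)) (sym (++-assoc rest [ u ] [ b ]))
      (atBack a rest u b (Linked.head (linked-suffix rest (proj₁ moved))) moved)
    where
    moved : Path (rest ++ u ∷ b ∷ [])
    moved = subst Path (++-assoc rest [ u ] [ b ]) (path-suffix [ a ] pth)

  slide : ∀ a x xs b → Path (a ∷ x ∷ xs ++ [ b ]) → (a ∷ x ∷ xs) ⇄ (x ∷ xs ++ [ b ])
  slide a x xs b pth =
    slide-forward a (x ∷ xs) b (s≤s z≤n) pth ◅ ε ,
    atFront x xs b a (Linked.head (proj₁ pth)) (path-prefix (a ∷ x ∷ xs) pth) ◅ ε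

  fromStart : ∀ A′ {W W′ B B′} → Path (W ++ B) → W ++ B ≡ A′ ++ W′ ++ B′ →
              length W ≡ length W′ → 1 < length W → W ⇄ W′
  fromStart [] {W} {W′} _ eq len _ = subst (W ⇄_) (++-prefix-unique W W′ eq len) ⇄-refl
  fromStart (_ ∷ _) {[]}    _ _ _ ()
  fromStart (_ ∷ _) {_ ∷ []} _ _ _ (s≤s ())
  fromStart (a′ ∷ A′) {w ∷ x ∷ xs} {W′} {[]} {B′} _ eq len _ =
    ⊥-elim (<-irrefl refl (subst (length W′ <_) whole (infix-shorter a′ A′ W′ B′)))
    where
    whole : length (a′ ∷ A′ ++ W′ ++ B′) ≡ length W′
    whole = trans (cong length (sym eq)) (trans (cong length (++-identityʳ (w ∷ x ∷ xs))) len)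
  fromStart (a′ ∷ A′) {w ∷ x ∷ xs} {W′} {b ∷ B} {B′} pth eq len _ =
    ⇄-trans (slide w x xs b (path-prefix (w ∷ x ∷ xs ++ [ b ]) shifted))
            (fromStart A′ (path-suffix [ w ] shifted) eq′ len′ long′)
    where
    regroup : (xs ++ [ b ]) ++ B ≡ xs ++ b ∷ B
    regroup = ++-assoc xs [ b ] B
    shifted : Path (w ∷ x ∷ (xs ++ [ b ]) ++ B)
    shifted = subst (λ t → Path (w ∷ x ∷ t)) (sym regroup) pth
    eq′ : (x ∷ xs ++ [ b ]) ++ B ≡ A′ ++ W′ ++ B′
    eq′ = trans (cong (x ∷_) regroup) (∷-injectiveʳ eq)
    len′ : length (x ∷ xs ++ [ b ]) ≡ length W′
    len′ = trans (cong suc (length-snoc xs)) len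
    long′ : 1 < length (x ∷ xs ++ [ b ])
    long′ = subst (1 <_) (sym (cong suc (length-snoc xs))) (s≤s (s≤s z≤n))

  windows-connected : ∀ {R W W′} → Path R → IsSubPath W R → IsSubPath W′ R →
                      length W ≡ length W′ → 1 < length W → W ⇄ W′
  windows-connected pth (A , B , refl) (A′ , B′ , eq′) = connect A A′ pth (sym eq′)
    where
    connect : ∀ A A′ {W W′ B B′} → Path (A ++ W ++ B) → A ++ W ++ B ≡ A′ ++ W′ ++ B′ →
              length W ≡ length W′ → 1 < length W → W ⇄ W′
    connect []      A′        pth eq len long = fromStart A′ pth eq len long
    connect (a ∷ A) []        pth eq len long =
      swap (fromStart (a ∷ A) (subst Path eq pth) (sym eq) (sym len) (subst (1 <_) len long))
    connect (a ∷ A) (_ ∷ A′) pth eq len long =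
      connect A A′ (path-suffix [ a ] pth) (∷-injectiveʳ eq) len long

  -- A path D ++ [w] crawls forward onto a path w ∷ C disjoint from D: both
  -- are windows of the glued path D ++ w ∷ C.
  crawl : ∀ D {w C} → Path (D ++ [ w ]) → Path (w ∷ C) → (∀ y → y ∈ D → y ∉ C) →
          length (D ++ [ w ]) ≡ length (w ∷ C) → 1 < length (D ++ [ w ]) →
          Reconf G (D ++ [ w ]) (w ∷ C)
  crawl D {w} {C} pD pC disjoint len long =
    proj₁ (windows-connected (path-glue D pD pC disjoint)
             ([] , C , ++-assoc D [ w ] C)
             (D , [] , cong (D ++_) (++-identityʳ (w ∷ C)))
             len long)

  Reading : List V → List V → Set
  Reading T q = T ≡ q ⊎ T ≡ reverse q

  reading-into : ∀ {p q T} → Reading T q → Reconf G p q → ReconfInto G p T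
  reading-into (inj₁ refl) r = inj₁ r
  reading-into (inj₂ refl) r = into-reverse (inj₁ r)

  reading-∈ : ∀ {q T y} → Reading T q → y ∈ q → y ∈ T
  reading-∈ (inj₁ refl) y∈q = y∈q
  reading-∈ (inj₂ refl) y∈q = reverse⁺ y∈q

  step-shape : ∀ {p q} → Step G p q → ∃₂ λ D w → Reading (D ++ [ w ]) q × (∀ {y} → y ∈ D → y ∈ p)
  step-shape (atBack v rest u w _ _) = rest ++ [ u ] , w , inj₁ (++-assoc rest [ u ] [ w ]) , there
  step-shape (atFront u rest v w _ _) =
    reverse (u ∷ rest) , w , inj₂ (sym (unfold-reverse w (u ∷ rest))) , old
    where
    old : ∀ {y} → y ∈ reverse (u ∷ rest) → y ∈ u ∷ rest ++ [ v ]
    old y∈ with reverse⁻ {xs = u ∷ rest} y∈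
    ... | here y≡u      = here y≡u
    ... | there y∈rest  = there (∈-++⁺ˡ y∈rest)

  -- p (which moves, hence has an edge) reaches a path D ++ [w] whose only
  -- vertex on R is its end w.
  Touch : List V → List V → Set
  Touch R p = ∃₂ λ D w →
    ReconfInto G p (D ++ [ w ]) × w ∈ R × (∀ y → y ∈ D → y ∉ R) × 1 < length p

  touch-prepend : ∀ {R p q} → Step G p q → Touch R q → Touch R p
  touch-prepend s (D , w , reach , w∈R , D∉R , _) =
    D , w , Sum.map (s ◅_) (s ◅_) reach , w∈R , D∉R , step-long s

  open import Data.List.Membership.DecPropositional (_≟_ {n}) using (_∈?_)

  -- If p avoids R but reconfigures into a path meeting R, then the first
  -- step bringing a vertex of R into the path yields a touch.
  firstTouch : ∀ {R p q} → Reconf G p q → (∀ y → y ∈ p → y ∉ R) →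
               ∀ {x} → x ∈ q → x ∈ R → Touch R p
  firstTouch ε avoid x∈q x∈R = ⊥-elim (avoid _ x∈q x∈R)
  firstTouch {R} (_◅_ {j = q₁} s r) avoid x∈q x∈R with step-shape s
  ... | D , w , reading , D⊆p with w ∈? R
  ...   | yes w∈R =
    D , w , reading-into reading (s ◅ ε) , w∈R , (λ y y∈D → avoid y (D⊆p y∈D)) , step-long s
  ...   | no w∉R = touch-prepend s (firstTouch r avoid′ x∈q x∈R)
    where
    -- the only vertex the step adds is w, which is off R
    avoid′ : ∀ y → y ∈ q₁ → y ∉ R
    avoid′ y y∈q with ∈-++⁻ D (reading-∈ reading y∈q)
    ... | inj₁ y∈D          = avoid y (D⊆p y∈D)
    ... | inj₂ (here refl)  = w∉R

  touches : ∀ {R p T x} → ReconfInto G p T → (∀ y → y ∈ p → y ∉ R) → x ∈ T → x ∈ R → Touch R p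
  touches (inj₁ r) avoid x∈T = firstTouch r avoid x∈T
  touches (inj₂ r) avoid x∈T = firstTouch r avoid (reverse⁺ x∈T)

  crawlAhead : ∀ {k R D w} → Path R → Ahead k R w → Path (D ++ [ w ]) →
               length (D ++ [ w ]) ≡ suc k → 1 < suc k → (∀ y → y ∈ D → y ∉ R) →
               ∃[ C ] (IsSubPath (w ∷ C) R × length C ≡ k × Reconf G (D ++ [ w ]) (w ∷ C))
  crawlAhead {D = D} pR ahead pDw lenDw long D∉R with aheadWindow ahead
  ... | C , sub , lenC =
    C , sub , lenC ,
    crawl D pDw (subpath-path sub pR) (λ y y∈D y∈C → D∉R y y∈D (subpath-∈ sub (there y∈C)))
      (trans lenDw (cong suc (sym lenC))) (subst (1 <_) (sym lenDw) long)

  -- From a touch with |p| = k+1 on a path R with 2k+1 vertices, p reaches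
  -- a window of R with k+1 vertices: crawl along R in the long direction.
  startWindow : ∀ {k R p D w} → Path R → length R ≡ suc (2 * k) →
                Path p → length p ≡ suc k → 1 < length p →
                ReconfInto G p (D ++ [ w ]) → w ∈ R → (∀ y → y ∈ D → y ∉ R) →
                ∃[ S ] (IsSubPath S R × length S ≡ suc k × ReconfInto G p S)
  startWindow {k} {R} {p} {D} {w} pR lenR pp lenp long reach w∈R D∉R = towards (longSide lenR w∈R)
    where
    pDw : Path (D ++ [ w ])
    pDw = into-path pp reach
    lenDw : length (D ++ [ w ]) ≡ suc k
    lenDw = trans (into-length reach) lenp
    long′ : 1 < suc k
    long′ = subst (1 <_) lenp long
    towards : Ahead k R w ⊎ Ahead k (reverse R) w →
              ∃[ S ] (IsSubPath S R × length S ≡ suc k × ReconfInto G p S)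
    towards (inj₁ ahead) with crawlAhead pR ahead pDw lenDw long′ D∉R
    ... | C , sub , lenC , r = w ∷ C , sub , cong suc lenC , into-then reach r
    towards (inj₂ ahead)
      with crawlAhead (path-reverse pR) ahead pDw lenDw long′ (λ y y∈D y∈R′ → D∉R y y∈D (reverse⁻ y∈R′))
    ... | C , sub , lenC , r =
      reverse (w ∷ C) , subpath-unreverse sub ,
      trans (length-reverse (w ∷ C)) (cong suc lenC) , into-reverse (into-then reach r)

lemma3 : ∀ {n} (G : Graph n) (k : ℕ) (P Q R : List (Fin n)) →
    IsPathOfLength G k P → IsPathOfLength G k Q →
    IsLoosePath G k P Q R →
    (∃[ S ] (ReconfInto G P S × IsPath G S × ∃[ x ] (x ∈ S × x ∈ R))) →
    ∀ v → v ∈ R →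
    ∃[ S ] (ReconfInto G P S × IsSubPath S R × IsEndpoint v S)
lemma3 G k P Q R (pP , lenP) _ ((pR , lenR) , R-off-PQ) (S , P↝S , _ , x , x∈S , x∈R) v v∈R
  with touches G P↝S (λ y y∈P y∈R → proj₁ (R-off-PQ y y∈R) y∈P) x∈S x∈R
... | D , w , P↝Dw , w∈R , D∉R , P-long
  with startWindow G pR lenR pP lenP P-long P↝Dw w∈R D∉R | endWindow lenR v∈R
...   | S₀ , S₀⊆R , lenS₀ , P↝S₀ | S₁ , S₁⊆R , lenS₁ , v-end =
  S₁ , into-then G P↝S₀ (proj₁ (windows-connected G pR S₀⊆R S₁⊆R same-length S₀-long)) ,
  S₁⊆R , v-end
  where
  same-length : length S₀ ≡ length S₁
  same-length = trans lenS₀ (sym lenS₁)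
  S₀-long : 1 < length S₀
  S₀-long = subst (1 <_) (trans lenP (sym lenS₀)) P-long
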